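{- Let $K$ be a $2$-geodetic orientation of a complete bipartite graph $K_{s,t}$ with $s \geq t \geq 2$. If $x$ is any vertex of $K$ that is neither a source nor a sink, then $d^+(x) = 1$ or $d^-(x) = 1$.
   Context: A digraph has a vertex set and an arc set consisting of ordered pairs of distinct vertices. A walk of length $\ell$ is a sequence $x_0x_1\dots x_\ell$ of vertices with $x_i \rightarrow x_{i+1}$ for all $i$. A digraph is $k$-geodetic if for every ordered pair $(u,v)$ of (not necessarily distinct) vertices there is at most one $u,v$-walk of length at most $k$. $d^+(x)$ and $d^-(x)$ denote the out-degree and in-degree of $x$. A source is a vertex of in-degree $0$, a sink a vertex of out-degree $0$. An orientation of an undirected graph is obtained by assigning a direction to each edge. -}

module Defs where

open import Data.Nat using (ℕ; zero; suc; _≤_)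
open import Data.Fin using (Fin)
open import Data.Bool using (Bool; true; false; not; T)
open import Data.Bool.Properties using (T?)
open import Data.Sum using (_⊎_; inj₁; inj₂)
open import Data.Product using (Σ; _,_)
open import Data.Empty using (⊥)
open import Data.List using (List; length; filter; map; allFin; _++_)
open import Relation.Nullary using (Dec; no)
open import Relation.Binary.PropositionalEquality using (_≡_)

-- An orientation of the complete bipartite graph K_{s,t} with parts
-- Fin s and Fin t: for every edge {a,b} (a : Fin s, b : Fin t),
-- o a b = true means a → b, and o a b = false means b → a.
Orientation : ℕ → ℕ → Set
Orientation s t = Fin s → Fin t → Bool

Vertex : ℕ → ℕ → Set
Vertex s t = Fin s ⊎ Fin t

module _ {s t : ℕ} (o : Orientation s t) where

  Arc : Vertex s t → Vertex s t → Set
  Arc (inj₁ a) (inj₂ b) = T (o a b)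
  Arc (inj₂ b) (inj₁ a) = T (not (o a b))
  Arc (inj₁ _) (inj₁ _) = ⊥
  Arc (inj₂ _) (inj₂ _) = ⊥

  arc? : (x y : Vertex s t) → Dec (Arc x y)
  arc? (inj₁ a) (inj₂ b) = T? (o a b)
  arc? (inj₂ b) (inj₁ a) = T? (not (o a b))
  arc? (inj₁ _) (inj₁ _) = no (λ ())
  arc? (inj₂ _) (inj₂ _) = no (λ ())

  vertices : List (Vertex s t)
  vertices = map inj₁ (allFin s) ++ map inj₂ (allFin t)

  outdeg : Vertex s t → ℕ
  outdeg x = length (filter (arc? x) vertices)

  indeg : Vertex s t → ℕ
  indeg x = length (filter (λ y → arc? y x) vertices)

  data Walk : Vertex s t → Vertex s t → ℕ → Set where
    nil  : ∀ {u} → Walk u u 0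
    cons : ∀ {u w v ℓ} → Arc u w → Walk w v ℓ → Walk u v (suc ℓ)

  Geodetic : ℕ → Set
  Geodetic k = ∀ (u v : Vertex s t) (ℓ₁ ℓ₂ : ℕ)
    (p : Walk u v ℓ₁) (q : Walk u v ℓ₂) → ℓ₁ ≤ k → ℓ₂ ≤ k →
    _≡_ {A = Σ ℕ (Walk u v)} (ℓ₁ , p) (ℓ₂ , q)

{-# OPTIONS --safe #-}
module Submission where

-- Suppose x had two in-neighbours b₁, b₂ and two out-neighbours c₁, c₂, and
-- let y ≠ x lie in the same part as x (possible since s ≥ t ≥ 2). Then y is
-- adjacent to all four. If y → b₁ and y → b₂, the walks y b₁ x and y b₂ x
-- coincide; so some bᵢ → y. Then x → c → y would clash with bᵢ x c and bᵢ y c,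
-- so every cⱼ → y, and x c₁ y, x c₂ y are two distinct 2-walks.

open import Defs
open import Data.Nat using (ℕ; _≥_; _≤_; s≤s; z≤n; _≟_)
open import Data.Nat.Properties using (≤-trans)
open import Data.Fin using (Fin; zero; suc)
open import Data.Bool using (true; false)
open import Data.Unit using (⊤; tt)
open import Data.Empty using (⊥; ⊥-elim)
open import Data.Sum using (_⊎_; inj₁; inj₂; swap)
open import Data.Sum.Properties using (inj₁-injective; inj₂-injective)
open import Data.Product using (Σ; ∃; _,_; _×_; proj₂)
open import Data.List using (List; []; _∷_; length; filter; map; allFin)
open import Data.List.Relation.Unary.Unique.Propositional using (Unique)
open import Data.List.Relation.Unary.AllPairs using (_∷_)
open import Data.List.Relation.Unary.All using (_∷_)
open import Data.List.Relation.Unary.Any using (here; there)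
open import Data.List.Membership.Propositional using (_∈_)
open import Data.List.Membership.Propositional.Properties using (∈-map⁻; ∈-filter⁻)
import Data.List.Relation.Unary.Unique.Propositional.Properties as Unique
open import Relation.Nullary using (yes; no; ¬_)
open import Relation.Unary using (Pred; Decidable)
open import Relation.Binary.PropositionalEquality using (_≡_; _≢_; refl)

distinct-members : ∀ {a} {A : Set a} {xs : List A} → Unique xs →
  length xs ≢ 0 → length xs ≢ 1 → Σ A λ y → Σ A λ z → y ∈ xs × z ∈ xs × y ≢ z
distinct-members {xs = []}         _               ≢0 _  = ⊥-elim (≢0 refl)
distinct-members {xs = _ ∷ []}     _               _  ≢1 = ⊥-elim (≢1 refl)
distinct-members {xs = y ∷ z ∷ _} ((y≢z ∷ _) ∷ _) _  _  =
  y , z , here refl , there (here refl) , y≢z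

distinct-satisfying : ∀ {a p} {A : Set a} {P : Pred A p} (P? : Decidable P) {xs : List A} →
  Unique xs → length (filter P? xs) ≢ 0 → length (filter P? xs) ≢ 1 →
  Σ A λ y → Σ A λ z → P y × P z × y ≢ z
distinct-satisfying P? {xs} unique ≢0 ≢1
  with distinct-members (Unique.filter⁺ P? unique) ≢0 ≢1
... | y , z , y∈ , z∈ , y≢z =
  y , z , proj₂ (∈-filter⁻ P? {xs = xs} y∈) , proj₂ (∈-filter⁻ P? {xs = xs} z∈) , y≢z

other-element : ∀ {n} → 2 ≤ n → (a : Fin n) → ∃ λ a′ → a ≢ a′
other-element (s≤s (s≤s _)) zero    = suc zero , λ ()
other-element (s≤s (s≤s _)) (suc _) = zero , λ ()

SamePart : ∀ {s t} → Vertex s t → Vertex s t → Set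
SamePart (inj₁ _) (inj₁ _) = ⊤
SamePart (inj₂ _) (inj₂ _) = ⊤
SamePart _        _        = ⊥

other-in-part : ∀ {s t} → 2 ≤ s → 2 ≤ t → (x : Vertex s t) →
  ∃ λ y → SamePart x y × x ≢ y
other-in-part 2≤s _ (inj₁ a) with other-element 2≤s a
... | a′ , a≢a′ = inj₁ a′ , tt , λ eq → a≢a′ (inj₁-injective eq)
other-in-part _ 2≤t (inj₂ b) with other-element 2≤t b
... | b′ , b≢b′ = inj₂ b′ , tt , λ eq → b≢b′ (inj₂-injective eq)

module _ {s t : ℕ} (o : Orientation s t) where

  Adjacent : Vertex s t → Vertex s t → Set
  Adjacent u v = Arc o u v ⊎ Arc o v u

  across-adjacent : (a : Fin s) (b : Fin t) → Adjacent (inj₁ a) (inj₂ b)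
  across-adjacent a b with o a b
  ... | true  = inj₁ tt
  ... | false = inj₂ tt

  adjacent-samePart : ∀ x y w → SamePart x y → Adjacent x w → Adjacent y w
  adjacent-samePart (inj₁ _) (inj₁ a) (inj₂ b) _ _ = across-adjacent a b
  adjacent-samePart (inj₂ _) (inj₂ b) (inj₁ a) _ _ = swap (across-adjacent a b)
  adjacent-samePart (inj₁ _) (inj₁ _) (inj₁ _) _ (inj₁ ())
  adjacent-samePart (inj₁ _) (inj₁ _) (inj₁ _) _ (inj₂ ())
  adjacent-samePart (inj₂ _) (inj₂ _) (inj₂ _) _ (inj₁ ())
  adjacent-samePart (inj₂ _) (inj₂ _) (inj₂ _) _ (inj₂ ())

  vertices-unique : Unique (vertices o)
  vertices-unique = Unique.++⁺
    (Unique.map⁺ inj₁-injective (Unique.allFin⁺ s))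
    (Unique.map⁺ inj₂-injective (Unique.allFin⁺ t))
    disjoint
    where
    disjoint : ∀ {v} → ¬ (v ∈ map inj₁ (allFin s) × v ∈ map inj₂ (allFin t))
    disjoint (v∈₁ , v∈₂) with ∈-map⁻ inj₁ v∈₁ | ∈-map⁻ inj₂ v∈₂
    ... | _ , _ , refl | _ , _ , ()

  module _ (geodetic : Geodetic o 2) where

    midpoint-unique : ∀ u v {w w′} →
      Arc o u w → Arc o w v → Arc o u w′ → Arc o w′ v → w ≡ w′
    midpoint-unique u v u→w w→v u→w′ w′→v
      with geodetic u v 2 2 (cons u→w (cons w→v nil)) (cons u→w′ (cons w′→v nil))
                    (s≤s (s≤s z≤n)) (s≤s (s≤s z≤n))
    ... | refl = refl

    no-common-in-neighbour : ∀ b x y {c₁ c₂} → SamePart x y → x ≢ y → c₁ ≢ c₂ →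
      Arc o b x → Arc o b y → Arc o x c₁ → Arc o x c₂ → ⊥
    no-common-in-neighbour b x y {c₁} {c₂} same x≢y c₁≢c₂ b→x b→y x→c₁ x→c₂
      with adjacent-samePart x y c₁ same (inj₁ x→c₁) | adjacent-samePart x y c₂ same (inj₁ x→c₂)
    ... | inj₁ y→c₁ | _         = x≢y (midpoint-unique b c₁ b→x x→c₁ b→y y→c₁)
    ... | _         | inj₁ y→c₂ = x≢y (midpoint-unique b c₂ b→x x→c₂ b→y y→c₂)
    ... | inj₂ c₁→y | inj₂ c₂→y = c₁≢c₂ (midpoint-unique x y x→c₁ c₁→y x→c₂ c₂→y)

    not-both-degrees-≥2 : ∀ x y {b₁ b₂ c₁ c₂} → SamePart x y → x ≢ y →
      b₁ ≢ b₂ → c₁ ≢ c₂ → Arc o b₁ x → Arc o b₂ x → Arc o x c₁ → Arc o x c₂ → ⊥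
    not-both-degrees-≥2 x y {b₁} {b₂} {c₁} {c₂} same x≢y b₁≢b₂ c₁≢c₂ b₁→x b₂→x x→c₁ x→c₂
      with adjacent-samePart x y b₁ same (inj₂ b₁→x) | adjacent-samePart x y b₂ same (inj₂ b₂→x)
    ... | inj₁ y→b₁ | inj₁ y→b₂ = b₁≢b₂ (midpoint-unique y x y→b₁ b₁→x y→b₂ b₂→x)
    ... | inj₂ b₁→y | _         = no-common-in-neighbour b₁ x y same x≢y c₁≢c₂ b₁→x b₁→y x→c₁ x→c₂
    ... | _         | inj₂ b₂→y = no-common-in-neighbour b₂ x y same x≢y c₁≢c₂ b₂→x b₂→y x→c₁ x→c₂

lemma11 : (s t : ℕ) → s ≥ t → t ≥ 2 → (o : Orientation s t) →
    Geodetic o 2 → (x : Vertex s t) →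
    indeg o x ≢ 0 → outdeg o x ≢ 0 →
    outdeg o x ≡ 1 ⊎ indeg o x ≡ 1
lemma11 s t s≥t t≥2 o geodetic x in≢0 out≢0 with outdeg o x ≟ 1 | indeg o x ≟ 1
... | yes out≡1 | _        = inj₁ out≡1
... | no _      | yes in≡1 = inj₂ in≡1
... | no out≢1  | no in≢1
  with other-in-part (≤-trans t≥2 s≥t) t≥2 x
     | distinct-satisfying (λ v → arc? o v x) (vertices-unique o) in≢0 in≢1
     | distinct-satisfying (arc? o x) (vertices-unique o) out≢0 out≢1
... | y , same , x≢y | b₁ , b₂ , b₁→x , b₂→x , b₁≢b₂ | c₁ , c₂ , x→c₁ , x→c₂ , c₁≢c₂ =
  ⊥-elim (not-both-degrees-≥2 o geodetic x y same x≢y b₁≢b₂ c₁≢c₂ b₁→x b₂→x x→c₁ x→c₂)
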